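{- Let $k\geq 2$ be an integer and let $D=(V,A)$ be the digraph defined below. Then $D$ is $k$-edge-connected. Construction: Let $I=\{0,\dots,2k-1\}$, $I_e=\{i\in I: i \text{ even}\}$, $I_o=I\setminus I_e$, and let $I^*$ be the set of finite sequences of elements of $I$ (including the empty sequence); concatenation of sequences is written by juxtaposition. The vertex set is $V=\{s_\mu:\mu\in I^*\}\cup\{t_\mu:\mu\in I^*\}$, all these vertices being pairwise distinct; write $s,t$ for $s_\mu,t_\mu$ when $\mu$ is empty. The (multi)edge set $A$ consists of: for every $\mu\in I^*$, exactly $k$ parallel edges in each direction between the two vertices of each of the pairs $\{s_\mu,t_{\mu1}\}$, $\{s_{\mu i},t_{\mu(i+2)}\}$ for $i=0,\dots,2k-3$, and $\{s_{\mu(2k-2)},t_\mu\}$; and, for every $\mu\in I^*$, the single directed edges $(s_\mu,t_{\mu0})$, $(t_{\mu i},s_{\mu(i+1)})$ for $i\in I_e$, $(s_{\mu i},t_{\mu(i+1)})$ for $i\in I_o\setminus\{2k-1\}$, and $(s_{\mu(2k-1)},t_\mu)$.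
   Context: All paths are finite, simple, directed paths. A digraph is called connected if for all vertices $u,v$ there is a directed $u\to v$ path. A digraph $D=(V,A)$ is $k$-edge-connected if for every $C\subseteq A$ with $|C|<k$ the digraph $(V,A\setminus C)$ is connected. -}

module Defs where

open import Data.Nat using (ℕ; _+_; _*_; _∸_; _<_; _≤_)
open import Data.Nat.Divisibility using (_∣_)
open import Data.Fin using (Fin; fromℕ<)
open import Data.List using (List; []; _∷_; _++_; [_])
open import Data.List.Membership.Propositional using (_∈_)
open import Data.Product using (Σ; _×_; _,_)
open import Relation.Nullary using (¬_)

Seq : ℕ → Set
Seq k = List (Fin (2 * k))

ext : ∀ k → Seq k → (i : ℕ) → i < 2 * k → Seq k
ext k μ i h = μ ++ [ fromℕ< h ]

data Vtx (k : ℕ) : Set where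
  s : Seq k → Vtx k
  t : Seq k → Vtx k

-- Arcs of the multidigraph D, indexed by tail and head.
-- Parallel edges are distinguished by a copy index c : Fin k.
data Arc (k : ℕ) : Vtx k → Vtx k → Set where
  a-s-t1 : ∀ (μ : Seq k) (h : 1 < 2 * k) (c : Fin k) → Arc k (s μ) (t (ext k μ 1 h))
  a-t1-s : ∀ (μ : Seq k) (h : 1 < 2 * k) (c : Fin k) → Arc k (t (ext k μ 1 h)) (s μ)
  a-si-ti2 : ∀ (μ : Seq k) i (h : i < 2 * k) (h₂ : i + 2 < 2 * k) (c : Fin k) →
             Arc k (s (ext k μ i h)) (t (ext k μ (i + 2) h₂))
  a-ti2-si : ∀ (μ : Seq k) i (h : i < 2 * k) (h₂ : i + 2 < 2 * k) (c : Fin k) →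
             Arc k (t (ext k μ (i + 2) h₂)) (s (ext k μ i h))
  a-s2k-2-t : ∀ (μ : Seq k) (h : 2 * k ∸ 2 < 2 * k) (c : Fin k) → Arc k (s (ext k μ (2 * k ∸ 2) h)) (t μ)
  a-t-s2k-2 : ∀ (μ : Seq k) (h : 2 * k ∸ 2 < 2 * k) (c : Fin k) → Arc k (t μ) (s (ext k μ (2 * k ∸ 2) h))
  b-s-t0 : ∀ (μ : Seq k) (h : 0 < 2 * k) → Arc k (s μ) (t (ext k μ 0 h))
  b-ti-si1 : ∀ (μ : Seq k) i → 2 ∣ i → (h : i < 2 * k) (h₁ : i + 1 < 2 * k) →
             Arc k (t (ext k μ i h)) (s (ext k μ (i + 1) h₁))
  b-si-ti1 : ∀ (μ : Seq k) i → ¬ (2 ∣ i) → (h : i < 2 * k) (h₁ : i + 1 < 2 * k) →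
             Arc k (s (ext k μ i h)) (t (ext k μ (i + 1) h₁))
  b-s2k-1-t : ∀ (μ : Seq k) (h : 2 * k ∸ 1 < 2 * k) → Arc k (s (ext k μ (2 * k ∸ 1) h)) (t μ)

Edge : ℕ → Set
Edge k = Σ (Vtx k × Vtx k) λ { (u , v) → Arc k u v }

edge : ∀ {k u v} → Arc k u v → Edge k
edge {u = u} {v} a = (u , v) , a

data Walk {k : ℕ} (C : List (Edge k)) : Vtx k → Vtx k → Set where
  nil  : ∀ {u} → Walk C u u
  cons : ∀ {u v w} (a : Arc k u v) → ¬ (edge a ∈ C) → Walk C v w → Walk C u w

Connected∖ : ∀ {k} → List (Edge k) → Set
Connected∖ {k} C = (u v : Vtx k) → Walk C u v

{-# OPTIONS --safe #-}
-- Fewer than k deleted edges cannot hit all k copies of a thick pair, so the thick pairs stay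
-- joined both ways. Deleted edges have bounded level, so deep enough every arc survives: the
-- zig-zag s_μ → t_μ0 → s_μ1 → t_μ2 → ⋯ → s_μ(2k-1) → t_μ of single arcs gives s_μ → t_μ, and
-- going down through the children gives t_μ → s_μ. Going up the tree: once all children of ν have
-- s ⇄ t, the thick pairs tie the odd children to s_ν and the even children to t_ν0, and s_ν, t_ν0
-- are joined by k routes in each direction, each through its own single arc (s_ν → t_ν0 or
-- s_νi → t_ν(i+1) for odd i; t_νi → s_ν(i+1) for even i), so one route survives. Hence
-- s_ν ⇄ t_ν ⇄ s_νi for all ν and i, and every vertex is joined to s_∅.
module Submission where

open import Defs
open import Data.Nat using (ℕ; zero; suc; _+_; _*_; _∸_; _≤_; _<_; z<s; s≤s)
open import Data.Nat.Properties
  using (_≟_; suc-injective; +-assoc; +-comm; +-suc; +-cancelʳ-≡; *-suc; *-cancelˡ-≡; ≤-reflexive; ≤-trans;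
         <⇒≢; <⇒≱; n<1+n; n≤1+n; m≤m+n; m+n≤o⇒m≤o; m+n≤o⇒n≤o; *-monoʳ-≤; *-monoʳ-<)
open import Data.Nat.Divisibility using (_∣_; _∤_; _∣?_; _∣0; ∣-refl; ∣m∣n⇒∣m+n; ∣m+n∣m⇒∣n; >⇒∤; m∣m*n)
open import Data.Fin using (Fin; zero; suc; toℕ)
open import Data.Fin.Properties using (toℕ-injective; toℕ<n; fromℕ<-toℕ; pigeonhole; ¬∀⟶∃¬)
open import Data.List using (List; []; [_]; _++_; length; map; lookup)
open import Data.List.Properties using (length-map; length-++-comm)
open import Data.List.Reverse using (Reverse; []; _∶_∶ʳ_; reverseView)
open import Data.List.Extrema.Nat using (max; xs≤max)
open import Data.List.Membership.Propositional using (_∈_; _∉_)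
open import Data.List.Membership.Propositional.Properties using (∈-map⁺)
open import Data.List.Membership.DecPropositional _≟_ using (_∈?_)
open import Data.List.Relation.Unary.All as All using ()
open import Data.List.Relation.Unary.Any using (index)
open import Data.List.Relation.Unary.Any.Properties using (lookup-index)
open import Data.Product using (∃; _×_; _,_; proj₁; proj₂; map₂)
open import Data.Empty using (⊥-elim)
open import Function using (_∘_)
open import Function.Definitions using (Injective)
open import Relation.Nullary using (¬_; yes; no)
open import Relation.Binary.PropositionalEquality using (_≡_; refl; sym; trans; cong; subst)

injective⇒∃∉ : ∀ {a} {A : Set a} {m} (tag : A → ℕ) (f : Fin m → A) →
               Injective _≡_ _≡_ (tag ∘ f) → (xs : List A) → length xs < m →
               ∃ λ i → f i ∉ xs
injective⇒∃∉ {m = m} tag f inj xs |xs|<m =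
  map₂ (λ tag∉ f∈ → tag∉ (∈-map⁺ tag f∈))
       (¬∀⟶∃¬ m (λ i → tag (f i) ∈ tags) (λ i → tag (f i) ∈? tags) not-all)
  where
  tags : List ℕ
  tags = map tag xs

  not-all : ¬ (∀ i → tag (f i) ∈ tags)
  not-all all∈ with pigeonhole (subst (_< m) (sym (length-map tag xs)) |xs|<m) (index ∘ all∈)
  ... | i , j , i<j , same-index = <⇒≢ i<j (cong toℕ (inj same-tag))
    where
    same-tag : tag (f i) ≡ tag (f j)
    same-tag = trans (lookup-index (all∈ i))
                   (trans (cong (lookup tags) same-index) (sym (lookup-index (all∈ j))))

2∤1 : 2 ∤ 1
2∤1 = >⇒∤ (n<1+n 1)

2∣2+n⇒2∣n : ∀ {n} → 2 ∣ 2 + n → 2 ∣ n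
2∣2+n⇒2∣n 2∣2+n = ∣m+n∣m⇒∣n 2∣2+n ∣-refl

2∤2+n⇒2∤n : ∀ {n} → 2 ∤ 2 + n → 2 ∤ n
2∤2+n⇒2∤n 2∤2+n 2∣n = 2∤2+n (∣m∣n⇒∣m+n ∣-refl 2∣n)

2∣n⇒2∤n+1 : ∀ {n} → 2 ∣ n → 2 ∤ n + 1
2∣n⇒2∤n+1 2∣n 2∣n+1 = 2∤1 (∣m+n∣m⇒∣n 2∣n+1 2∣n)

n+1+1≡2+n : ∀ n → n + 1 + 1 ≡ 2 + n
n+1+1≡2+n n = trans (+-assoc n 1 1) (+-comm n 2)

2∣n⇒2∣n+1+1 : ∀ {n} → 2 ∣ n → 2 ∣ n + 1 + 1
2∣n⇒2∣n+1+1 {n} 2∣n = subst (2 ∣_) (sym (n+1+1≡2+n n)) (∣m∣n⇒∣m+n ∣-refl 2∣n)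

2*n+1+1≡2*[1+n] : ∀ n → 2 * n + 1 + 1 ≡ 2 * suc n
2*n+1+1≡2*[1+n] n = trans (n+1+1≡2+n (2 * n)) (sym (*-suc 2 n))

2*m+1<2*n : ∀ {m n} → m < n → 2 * m + 1 < 2 * n
2*m+1<2*n {m} m<n =
  ≤-trans (≤-reflexive (trans (+-comm 1 (2 * m + 1)) (2*n+1+1≡2*[1+n] m))) (*-monoʳ-≤ 2 m<n)

-- fromℕ< ignores its bound proof, so ext k μ i h depends on h only up to definitional equality;
-- only equations between indices need casting.
ext-cong : ∀ {k} μ {i j} → i ≡ j → (h : i < 2 * k) (h′ : j < 2 * k) → ext k μ i h ≡ ext k μ j h′
ext-cong μ refl _ _ = refl

module _ {k : ℕ} {C : List (Edge k)} where

  infixr 5 _◅◅_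

  _◅◅_ : ∀ {u v w} → Walk C u v → Walk C v w → Walk C u w
  nil ◅◅ q = q
  cons a a∉C p ◅◅ q = cons a a∉C (p ◅◅ q)

  arc : ∀ {u v} (a : Arc k u v) → edge a ∉ C → Walk C u v
  arc a a∉C = cons a a∉C nil

  walk-≡ : ∀ {u v} → u ≡ v → Walk C u v
  walk-≡ refl = nil

-- Parallel arcs are tagged by their copy index, single arcs by the last index of their t-end, so
-- each family of alternative routes below has distinct tags (and membership in C becomes decidable).
tag : ∀ {k} → Edge k → ℕ
tag (_ , a-s-t1 μ h c) = toℕ c
tag (_ , a-t1-s μ h c) = toℕ c
tag (_ , a-si-ti2 μ i h h₂ c) = toℕ c
tag (_ , a-ti2-si μ i h h₂ c) = toℕ c
tag (_ , a-s2k-2-t μ h c) = toℕ c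
tag (_ , a-t-s2k-2 μ h c) = toℕ c
tag (_ , b-s-t0 μ h) = 0
tag (_ , b-ti-si1 μ i _ _ _) = i
tag (_ , b-si-ti1 μ i _ _ _) = suc i
tag (_ , b-s2k-1-t μ h) = 0

level : ∀ {k} → Edge k → ℕ
level (_ , a-s-t1 μ h c) = length μ
level (_ , a-t1-s μ h c) = length μ
level (_ , a-si-ti2 μ i h h₂ c) = length μ
level (_ , a-ti2-si μ i h h₂ c) = length μ
level (_ , a-s2k-2-t μ h c) = length μ
level (_ , a-t-s2k-2 μ h c) = length μ
level (_ , b-s-t0 μ h) = length μ
level (_ , b-ti-si1 μ i _ _ _) = length μ
level (_ , b-si-ti1 μ i _ _ _) = length μ
level (_ , b-s2k-1-t μ h) = length μ

module Connectivity {K : ℕ} (C : List (Edge (suc K))) (|C|<k : length C < suc K) where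

  k : ℕ
  k = suc K

  infix 4 _⇄_

  _⇄_ : Vtx k → Vtx k → Set
  u ⇄ v = Walk C u v × Walk C v u

  ⇄-refl : ∀ {u} → u ⇄ u
  ⇄-refl = nil , nil

  ⇄-sym : ∀ {u v} → u ⇄ v → v ⇄ u
  ⇄-sym (p , q) = q , p

  ⇄-trans : ∀ {u v w} → u ⇄ v → v ⇄ w → u ⇄ w
  ⇄-trans (p , q) (p′ , q′) = p ◅◅ p′ , q′ ◅◅ q

  route : ∀ {u v} (F : Fin k → Edge k) → Injective _≡_ _≡_ (tag ∘ F) →
          (∀ j → F j ∉ C → Walk C u v) → Walk C u v
  route F inj walk = let j , Fj∉C = injective⇒∃∉ tag F inj C |C|<k in walk j Fj∉C

  parallel : ∀ {u v} (a : Fin k → Arc k u v) → Injective _≡_ _≡_ (tag ∘ edge ∘ a) → Walk C u v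
  parallel a inj = route (edge ∘ a) inj (λ c → arc (a c))

  thick₁ : ∀ μ h → s μ ⇄ t (ext k μ 1 h)
  thick₁ μ h = parallel (a-s-t1 μ h) toℕ-injective , parallel (a-t1-s μ h) toℕ-injective

  thick₂ : ∀ μ i {j} (h : i < 2 * k) (h₂ : j < 2 * k) → i + 2 ≡ j →
           s (ext k μ i h) ⇄ t (ext k μ j h₂)
  thick₂ μ i h h₂ refl =
    parallel (a-si-ti2 μ i h h₂) toℕ-injective , parallel (a-ti2-si μ i h h₂) toℕ-injective

  thick-last : ∀ μ {i} (h : i < 2 * k) → 2 * k ∸ 2 ≡ i → s (ext k μ i h) ⇄ t μ
  thick-last μ h refl = parallel (a-s2k-2-t μ h) toℕ-injective , parallel (a-t-s2k-2 μ h) toℕ-injective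

  2k∸2≡2K : 2 * k ∸ 2 ≡ 2 * K
  2k∸2≡2K = cong (_∸ 2) (*-suc 2 K)

  2K+1<2k : 2 * K + 1 < 2 * k
  2K+1<2k = 2*m+1<2*n (n<1+n K)

  2K<2k : 2 * K < 2 * k
  2K<2k = m+n≤o⇒m≤o (suc (2 * K)) 2K+1<2k

  t₀ : Seq k → Vtx k
  t₀ ν = t (ext k ν 0 z<s)

  -- Stated for any transitive R: at levels free of deleted arcs only s → t is known for the
  -- children, so it is used there with one-way walks, and elsewhere with mutual reachability.
  module Chains {R : Vtx k → Vtx k → Set}
    (R-refl : ∀ {u} → R u u) (_∙_ : ∀ {u v w} → R u v → R v w → R u w) (ν : Seq k)
    (thick₁ : ∀ h → R (t (ext k ν 1 h)) (s ν))
    (thick₂ : ∀ i h h₂ → R (t (ext k ν (2 + i) h₂)) (s (ext k ν i h)))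
    (child : ∀ i h → R (s (ext k ν i h)) (t (ext k ν i h))) where

    t-even⇝t₀ : ∀ i h → 2 ∣ i → R (t (ext k ν i h)) (t₀ ν)
    t-even⇝t₀ 0 h _ = R-refl
    t-even⇝t₀ 1 h 2∣1 = ⊥-elim (2∤1 2∣1)
    t-even⇝t₀ (suc (suc i)) h 2∣2+i =
      thick₂ i h′ h ∙ (child i h′ ∙ t-even⇝t₀ i h′ (2∣2+n⇒2∣n 2∣2+i))
      where
      h′ : i < 2 * k
      h′ = m+n≤o⇒n≤o 2 h

    t-odd⇝s : ∀ i h → 2 ∤ i → R (t (ext k ν i h)) (s ν)
    t-odd⇝s 0 h 2∤0 = ⊥-elim (2∤0 (2 ∣0))
    t-odd⇝s 1 h _ = thick₁ h
    t-odd⇝s (suc (suc i)) h 2∤2+i =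
      thick₂ i h′ h ∙ (child i h′ ∙ t-odd⇝s i h′ (2∤2+n⇒2∤n 2∤2+i))
      where
      h′ : i < 2 * k
      h′ = m+n≤o⇒n≤o 2 h

  depth : ℕ
  depth = suc (max 0 (map level C))

  level<depth : ∀ {e} → e ∈ C → level e < depth
  level<depth e∈C = s≤s (All.lookup (xs≤max 0 (map level C)) (∈-map⁺ level e∈C))

  fresh-arc : ∀ {u v} (a : Arc k u v) → depth ≤ level (edge a) → Walk C u v
  fresh-arc a d≤ = arc a (λ a∈C → <⇒≱ (level<depth a∈C) d≤)

  module Fresh (μ : Seq k) (d≤ : depth ≤ length μ) where

    s⇝t-even : ∀ i h → 2 ∣ i → Walk C (s μ) (t (ext k μ i h))
    s⇝t-even 0 h _ = fresh-arc (b-s-t0 μ h) d≤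
    s⇝t-even 1 h 2∣1 = ⊥-elim (2∤1 2∣1)
    s⇝t-even (suc (suc i)) h 2∣2+i =
      s⇝t-even i h₀ 2∣i
      ◅◅ fresh-arc (b-ti-si1 μ i 2∣i h₀ h₁) d≤
      ◅◅ fresh-arc (b-si-ti1 μ (i + 1) (2∣n⇒2∤n+1 2∣i) h₁ h₂) d≤
      ◅◅ walk-≡ (cong t (ext-cong {k} μ (n+1+1≡2+n i) h₂ h))
      where
      2∣i : 2 ∣ i
      2∣i = 2∣2+n⇒2∣n 2∣2+i
      h₂ : i + 1 + 1 < 2 * k
      h₂ = subst (_< 2 * k) (sym (n+1+1≡2+n i)) h
      h₁ : i + 1 < 2 * k
      h₁ = m+n≤o⇒m≤o (suc (i + 1)) h₂
      h₀ : i < 2 * k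
      h₀ = m+n≤o⇒m≤o (suc i) h₁

    s→t : Walk C (s μ) (t μ)
    s→t = s⇝t-even (2 * K) 2K<2k (m∣m*n K)
          ◅◅ fresh-arc (b-ti-si1 μ (2 * K) (m∣m*n K) 2K<2k 2K+1<2k) d≤
          ◅◅ walk-≡ (cong s (ext-cong {k} μ 2K+1≡2k∸1 2K+1<2k 2k∸1<2k))
          ◅◅ fresh-arc (b-s2k-1-t μ 2k∸1<2k) d≤
      where
      2K+1≡2k∸1 : 2 * K + 1 ≡ 2 * k ∸ 1
      2K+1≡2k∸1 = trans (+-comm (2 * K) 1) (cong (_∸ 1) (sym (*-suc 2 K)))
      2k∸1<2k : 2 * k ∸ 1 < 2 * k
      2k∸1<2k = subst (_< 2 * k) 2K+1≡2k∸1 2K+1<2k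

  fresh-s⇄t : ∀ ν → depth ≤ length ν → s ν ⇄ t ν
  fresh-s⇄t ν d≤ = Fresh.s→t ν d≤ , t→s
    where
    fresh-child : ∀ i h → depth ≤ length (ext k ν i h)
    fresh-child i h = ≤-trans d≤ (≤-trans (n≤1+n _) (≤-reflexive (sym (length-++-comm ν _))))

    open Chains {R = Walk C} nil _◅◅_ ν (λ h → proj₂ (thick₁ ν h))
      (λ i h h₂ → proj₂ (thick₂ ν i h h₂ (+-comm i 2))) (λ i h → Fresh.s→t (ext k ν i h) (fresh-child i h))

    1<2k : 1 < 2 * k
    1<2k = 2*m+1<2*n {0} z<s

    t→s : Walk C (t ν) (s ν)
    t→s = proj₂ (thick-last ν 2K<2k 2k∸2≡2K)
          ◅◅ Fresh.s→t (ext k ν (2 * K) 2K<2k) (fresh-child (2 * K) 2K<2k)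
          ◅◅ t-even⇝t₀ (2 * K) 2K<2k (m∣m*n K)
          ◅◅ fresh-arc (b-ti-si1 ν 0 (2 ∣0) z<s 1<2k) d≤
          ◅◅ Fresh.s→t (ext k ν 1 1<2k) (fresh-child 1 1<2k)
          ◅◅ t-odd⇝s 1 1<2k 2∤1

  module FromChildren (ν : Seq k) (child : ∀ i h → s (ext k ν i h) ⇄ t (ext k ν i h)) where

    open Chains {R = _⇄_} ⇄-refl ⇄-trans ν (λ h → ⇄-sym (thick₁ ν h))
      (λ i h h₂ → ⇄-sym (thick₂ ν i h h₂ (+-comm i 2))) child

    s→t₀ : Walk C (s ν) (t₀ ν)
    s→t₀ = route into-even into-even-injective via
      where
      even< : (j : Fin K) → 2 * toℕ j + 1 + 1 < 2 * k
      even< j = subst (_< 2 * k) (sym (2*n+1+1≡2*[1+n] (toℕ j))) (*-monoʳ-< 2 (s≤s (toℕ<n j)))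
      odd< : (j : Fin K) → 2 * toℕ j + 1 < 2 * k
      odd< j = m+n≤o⇒m≤o (suc (2 * toℕ j + 1)) (even< j)
      odd : (j : Fin K) → 2 ∤ 2 * toℕ j + 1
      odd j = 2∣n⇒2∤n+1 (m∣m*n (toℕ j))

      into-even : Fin k → Edge k
      into-even zero = edge (b-s-t0 ν z<s)
      into-even (suc j) = edge (b-si-ti1 ν (2 * toℕ j + 1) (odd j) (odd< j) (even< j))

      into-even-injective : Injective _≡_ _≡_ (tag ∘ into-even)
      into-even-injective {zero} {zero} _ = refl
      into-even-injective {suc i} {suc j} eq =
        cong suc (toℕ-injective (*-cancelˡ-≡ _ _ 2 (+-cancelʳ-≡ _ _ _ (suc-injective eq))))

      via : ∀ j → into-even j ∉ C → Walk C (s ν) (t₀ ν)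
      via zero a∉C = arc (b-s-t0 ν z<s) a∉C
      via (suc j) a∉C =
        proj₂ (t-odd⇝s _ (odd< j) (odd j))
        ◅◅ proj₂ (child _ (odd< j))
        ◅◅ arc (b-si-ti1 ν (2 * toℕ j + 1) (odd j) (odd< j) (even< j)) a∉C
        ◅◅ proj₁ (t-even⇝t₀ _ (even< j) (2∣n⇒2∣n+1+1 (m∣m*n (toℕ j))))

    t₀→s : Walk C (t₀ ν) (s ν)
    t₀→s = route out-of-even out-of-even-injective via
      where
      odd< : (j : Fin k) → 2 * toℕ j + 1 < 2 * k
      odd< j = 2*m+1<2*n (toℕ<n j)
      even< : (j : Fin k) → 2 * toℕ j < 2 * k
      even< j = m+n≤o⇒m≤o (suc (2 * toℕ j)) (odd< j)

      even : (j : Fin k) → 2 ∣ 2 * toℕ j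
      even j = m∣m*n (toℕ j)

      out-of-even : Fin k → Edge k
      out-of-even j = edge (b-ti-si1 ν (2 * toℕ j) (even j) (even< j) (odd< j))

      out-of-even-injective : Injective _≡_ _≡_ (tag ∘ out-of-even)
      out-of-even-injective eq = toℕ-injective (*-cancelˡ-≡ _ _ 2 eq)

      via : ∀ j → out-of-even j ∉ C → Walk C (t₀ ν) (s ν)
      via j a∉C =
        proj₂ (t-even⇝t₀ _ (even< j) (even j))
        ◅◅ arc (b-ti-si1 ν (2 * toℕ j) (even j) (even< j) (odd< j)) a∉C
        ◅◅ proj₁ (child _ (odd< j))
        ◅◅ proj₁ (t-odd⇝s _ (odd< j) (2∣n⇒2∤n+1 (even j)))

    t₀⇄s : t₀ ν ⇄ s ν
    t₀⇄s = t₀→s , s→t₀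

    t-child⇄s : ∀ i h → t (ext k ν i h) ⇄ s ν
    t-child⇄s i h with 2 ∣? i
    ... | yes 2∣i = ⇄-trans (t-even⇝t₀ i h 2∣i) t₀⇄s
    ... | no 2∤i = t-odd⇝s i h 2∤i

    s-child⇄s : ∀ i h → s (ext k ν i h) ⇄ s ν
    s-child⇄s i h = ⇄-trans (child i h) (t-child⇄s i h)

    s⇄t : s ν ⇄ t ν
    s⇄t = ⇄-trans (⇄-sym (s-child⇄s (2 * K) 2K<2k)) (thick-last ν 2K<2k 2k∸2≡2K)

  s⇄t-above : ∀ d ν → depth ≤ d + length ν → s ν ⇄ t ν
  s⇄t-above zero ν d≤ = fresh-s⇄t ν d≤
  s⇄t-above (suc d) ν d≤ = FromChildren.s⇄t ν (λ i h → s⇄t-above d (ext k ν i h) (d≤′ i h))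
    where
    d≤′ : ∀ i h → depth ≤ d + length (ext k ν i h)
    d≤′ i h = subst (depth ≤_) (trans (sym (+-suc d _)) (cong (d +_) (sym (length-++-comm ν _)))) d≤

  s⇄t : ∀ ν → s ν ⇄ t ν
  s⇄t ν = s⇄t-above depth ν (m≤m+n depth _)

  s⇄s[] : ∀ {μ} → Reverse μ → s μ ⇄ s []
  s⇄s[] [] = ⇄-refl
  s⇄s[] (ν ∶ r ∶ʳ x) =
    ⇄-trans (subst (λ y → s (ν ++ [ y ]) ⇄ s ν) (fromℕ<-toℕ x (toℕ<n x))
               (FromChildren.s-child⇄s ν (λ i h → s⇄t (ext k ν i h)) (toℕ x) (toℕ<n x)))
            (s⇄s[] r)

  ⇄s[] : ∀ u → u ⇄ s []
  ⇄s[] (s μ) = s⇄s[] (reverseView μ)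
  ⇄s[] (t μ) = ⇄-trans (⇄-sym (s⇄t μ)) (s⇄s[] (reverseView μ))

  connected : Connected∖ C
  connected u v = proj₁ (⇄s[] u) ◅◅ proj₂ (⇄s[] v)

lemma1 : (k : ℕ) → 2 ≤ k → (C : List (Edge k)) → length C < k → Connected∖ C
lemma1 zero _ C ()
lemma1 (suc K) _ C |C|<k = Connectivity.connected C |C|<k
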